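{- Let $\Omega$ be a finite set of size $n$ and $1\le r\le n$. Let $\mathcal{H}$ be a hypergraph on $\Omega$ such that $\mathcal{U}_{r,\Omega}\leqslant\mathcal{H}$ and $\mathcal{U}_{r,\Omega}\neq\mathcal{H}$. Then there exists a domination completion $\mathcal{H}_0\in\mathrm{Dom}(r,\Omega)$ of $\mathcal{U}_{r,\Omega}$ such that $\mathcal{H}\not\leqslant\mathcal{H}_0$.
   Context: Graphs are finite, simple, undirected; $\mathcal{D}(G)$ is the family of inclusion-minimal dominating sets of $G$ (a dominating set is $D\subseteq V(G)$ such that every vertex outside $D$ has a neighbour in $D$). A hypergraph on $\Omega$ is a nonempty family of nonempty subsets of $\Omega$, none a proper subset of another; it has ground set $\Omega$ if the union of its members is $\Omega$. A domination hypergraph is one of the form $\mathcal{D}(G)$ for a graph $G$. $\mathcal{U}_{r,\Omega}=\{A\subseteq\Omega:|A|=r\}$. For hypergraphs $\mathcal{H}_1,\mathcal{H}_2$ on $\Omega$, $\mathcal{H}_1\leqslant\mathcal{H}_2$ means: for every $A_1\in\mathcal{H}_1$ there is $A_2\in\mathcal{H}_2$ with $A_2\subseteq A_1$ (a partial order). $\mathrm{Dom}(r,\Omega)$ is the set of domination hypergraphs $\mathcal{H}$ with ground set $\Omega$ such that $\mathcal{U}_{r,\Omega}\leqslant\mathcal{H}$ (domination completions). -}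

module Defs where

open import Data.Nat using (ℕ)
open import Data.Bool using (Bool; true; false)
open import Data.Fin using (Fin)
open import Data.Fin.Subset using (Subset; _∈_; _∉_; _⊆_; _⊂_; ∣_∣; Nonempty)
open import Data.Product using (Σ; ∃; _×_; _,_)
open import Relation.Nullary using (¬_)
open import Relation.Binary.PropositionalEquality using (_≡_)
open import Function.Bundles using (_⇔_)

-- Ω = Fin n.  A family of subsets of Ω is a predicate on Subset n.
Family : ℕ → Set₁
Family n = Subset n → Set

record Graph (n : ℕ) : Set where
  field
    adj    : Fin n → Fin n → Bool
    sym    : ∀ u v → adj u v ≡ adj v u
    irrefl : ∀ v → adj v v ≡ false

Adj : ∀ {n} → Graph n → Fin n → Fin n → Set
Adj G u v = Graph.adj G u v ≡ true

IsDominating : ∀ {n} → Graph n → Subset n → Set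
IsDominating G D = ∀ v → v ∉ D → ∃ λ u → u ∈ D × Adj G u v

IsMinDominating : ∀ {n} → Graph n → Subset n → Set
IsMinDominating G D = IsDominating G D × (∀ D′ → D′ ⊂ D → ¬ IsDominating G D′)

𝒟 : ∀ {n} → Graph n → Family n
𝒟 G = IsMinDominating G

IsHypergraph : ∀ {n} → Family n → Set
IsHypergraph {n} H =
  (∃ λ A → H A) ×
  (∀ A → H A → Nonempty A) ×
  (∀ A B → H A → H B → ¬ (A ⊂ B))

HasGroundSet : ∀ {n} → Family n → Set
HasGroundSet {n} H = ∀ (x : Fin n) → ∃ λ A → H A × x ∈ A

_≐_ : ∀ {n} → Family n → Family n → Set
H₁ ≐ H₂ = ∀ A → H₁ A ⇔ H₂ A

IsDominationHypergraph : ∀ {n} → Family n → Set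
IsDominationHypergraph {n} H = Σ (Graph n) λ G → H ≐ 𝒟 G

𝒰 : ∀ {n} → ℕ → Family n
𝒰 r A = ∣ A ∣ ≡ r

_⩽_ : ∀ {n} → Family n → Family n → Set
H₁ ⩽ H₂ = ∀ A₁ → H₁ A₁ → ∃ λ A₂ → H₂ A₂ × A₂ ⊆ A₁

InDom : ∀ {n} → ℕ → Family n → Set
InDom {n} r H = IsDominationHypergraph H × HasGroundSet H × (𝒰 {n} r ⩽ H)

-- If 𝒰_r ⩽ H but H ≠ 𝒰_r, then, H being an antichain, not every r-set can belong
-- to H, so some r-set S lies strictly above a member A of H; pick a ∈ A and
-- w ∈ S ∖ A.  Delete from the complete graph on Ω all edges between w and A.  Its
-- minimal dominating sets are the singletons {x} with x ∉ A ∪ {w} and the pairs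
-- {w, a} with a ∈ A; these cover Ω, and every r-set contains one of them because
-- 1 ≤ |A| < r.  But no subset of A dominates w, so A has no member of 𝒟(G) below it.
module Submission where

open import Defs
open import Data.Nat using (ℕ; _≤_)
open import Data.Product using (Σ; _×_)
open import Relation.Nullary using (¬_)

open import Data.Nat using (zero; suc; _<_; z≤n; s≤s; _≟_)
open import Data.Nat.Properties
  using (≤-antisym; ≰⇒>; _≤?_; ≤-total; ≡-irrelevant; <⇒≢; <-≤-trans; ≤-<-trans)
open import Data.Fin using (Fin)
import Data.Fin.Properties as Fin
open import Data.Fin.Subset using (Subset; _∈_; _∉_; _⊆_; _⊂_; ∣_∣; _∪_; ⁅_⁆; ⊤; ⊥; inside; outside)
open import Data.Fin.Subset.Properties
open import Data.Vec using ([]; _∷_; here)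
open import Data.Vec.Properties using (≡-dec)
open import Data.Product using (∃; ∃₂; _,_; proj₁; proj₂)
open import Data.Sum using (_⊎_; inj₁; inj₂)
open import Data.Empty using (⊥-elim)
open import Function using (id; _∘_)
open import Function.Bundles using (mk⇔)
open import Relation.Nullary using (Dec; yes; no; ¬?; contradiction)
open import Relation.Nullary.Decidable using (does; decidable-stable; _×-dec_; dec-true; dec-false; does-⇔)
open import Relation.Binary.PropositionalEquality
  using (_≡_; _≢_; refl; sym; trans; subst; cong)
import Data.Bool.Properties as Bool

private
  variable
    n : ℕ

⊆∧≢⇒⊂ : {p q : Subset n} → p ⊆ q → p ≢ q → p ⊂ q
⊆∧≢⇒⊂ {p = p} {q} p⊆q p≢q with Fin.any? (λ x → (x ∈? q) ×-dec ¬? (x ∈? p))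
... | yes (x , x∈q , x∉p) = p⊆q , x , x∈q , x∉p
... | no ∄ = contradiction (⊆-antisym p⊆q q⊆p) p≢q
  where
  q⊆p : q ⊆ p
  q⊆p {x} x∈q with x ∈? p
  ... | yes x∈p = x∈p
  ... | no x∉p = ⊥-elim (∄ (x , x∈q , x∉p))

⊆-sandwich : ∀ (p q : Subset n) → p ⊆ q → ∀ k → ∣ p ∣ ≤ k → k ≤ ∣ q ∣ →
             ∃ λ m → p ⊆ m × m ⊆ q × ∣ m ∣ ≡ k
⊆-sandwich [] [] _ zero _ _ = [] , id , id , refl
⊆-sandwich (inside ∷ p) (outside ∷ q) p⊆q k _ _ with () ← p⊆q here
⊆-sandwich (inside ∷ p) (inside ∷ q) p⊆q (suc k) (s≤s p≤k) (s≤s k≤q)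
  with m , p⊆m , m⊆q , ∣m∣≡k ← ⊆-sandwich p q (drop-∷-⊆ p⊆q) k p≤k k≤q
  = inside ∷ m , s⊆s p⊆m , s⊆s m⊆q , cong suc ∣m∣≡k
⊆-sandwich (outside ∷ p) (outside ∷ q) p⊆q k p≤k k≤q
  with m , p⊆m , m⊆q , ∣m∣≡k ← ⊆-sandwich p q (drop-∷-⊆ p⊆q) k p≤k k≤q
  = outside ∷ m , s⊆s p⊆m , s⊆s m⊆q , ∣m∣≡k
⊆-sandwich (outside ∷ p) (inside ∷ q) p⊆q k p≤k k≤1+q with k ≤? ∣ q ∣
... | yes k≤q with m , p⊆m , m⊆q , ∣m∣≡k ← ⊆-sandwich p q (drop-∷-⊆ p⊆q) k p≤k k≤q
  = outside ∷ m , s⊆s p⊆m , out⊆ m⊆q , ∣m∣≡k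
... | no k≰q = inside ∷ q , p⊆q , id , ≤-antisym (≰⇒> k≰q) k≤1+q

x∈p⇒⁅x⁆⊆p : ∀ {x} {p : Subset n} → x ∈ p → ⁅ x ⁆ ⊆ p
x∈p⇒⁅x⁆⊆p {x = x} x∈p y∈⁅x⁆ with refl ← x∈⁅y⁆⇒x≡y x y∈⁅x⁆ = x∈p

x,y∈p⇒⁅x⁆∪⁅y⁆⊆p : ∀ {x y} {p : Subset n} → x ∈ p → y ∈ p → ⁅ x ⁆ ∪ ⁅ y ⁆ ⊆ p
x,y∈p⇒⁅x⁆∪⁅y⁆⊆p {x = x} {y} x∈p y∈p z∈ with x∈p∪q⁻ ⁅ x ⁆ ⁅ y ⁆ z∈
... | inj₁ z∈⁅x⁆ = x∈p⇒⁅x⁆⊆p x∈p z∈⁅x⁆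
... | inj₂ z∈⁅y⁆ = x∈p⇒⁅x⁆⊆p y∈p z∈⁅y⁆

⊆⁅x⁆∪q∧x∉⇒⊆q : ∀ {x} {p q : Subset n} → p ⊆ ⁅ x ⁆ ∪ q → x ∉ p → p ⊆ q
⊆⁅x⁆∪q∧x∉⇒⊆q {x = x} {q = q} p⊆ x∉p y∈p with x∈p∪q⁻ ⁅ x ⁆ q (p⊆ y∈p)
... | inj₁ y∈⁅x⁆ with refl ← x∈⁅y⁆⇒x≡y x y∈⁅x⁆ = contradiction y∈p x∉p
... | inj₂ y∈q = y∈q

escapes⊎straddles : ∀ {S A : Subset n} {w} → ∣ A ∣ < ∣ S ∣ → 1 < ∣ S ∣ →
  (∃ λ x → x ∈ S × x ∉ A × x ≢ w) ⊎ (w ∈ S × ∃ λ a → a ∈ S × a ∈ A)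
escapes⊎straddles {S = S} {A} {w} ∣A∣<∣S∣ 1<∣S∣
  with Fin.any? (λ x → (x ∈? S) ×-dec ¬? (x ∈? A) ×-dec ¬? (x Fin.≟ w))
... | yes escapes = inj₁ escapes
... | no ∄ with w ∈? S
...   | no w∉S = ⊥-elim (<⇒≢ (<-≤-trans ∣A∣<∣S∣ (p⊆q⇒∣p∣≤∣q∣ S⊆A)) refl)
  where
  S⊆A : S ⊆ A
  S⊆A {x} x∈S with x ∈? A | x Fin.≟ w
  ... | yes x∈A | _ = x∈A
  ... | no _ | yes refl = contradiction x∈S w∉S
  ... | no x∉A | no x≢w = ⊥-elim (∄ (x , x∈S , x∉A , x≢w))
...   | yes w∈S with Fin.any? (λ a → (a ∈? S) ×-dec (a ∈? A))
...     | yes straddles = inj₂ (w∈S , straddles)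
...     | no ∄′ = ⊥-elim (<⇒≢ (<-≤-trans 1<∣S∣ ∣S∣≤1) refl)
  where
  S⊆⁅w⁆ : S ⊆ ⁅ w ⁆
  S⊆⁅w⁆ {x} x∈S with x ∈? A | x Fin.≟ w
  ... | yes x∈A | _ = ⊥-elim (∄′ (x , x∈S , x∈A))
  ... | no _ | yes refl = x∈⁅x⁆ x
  ... | no x∉A | no x≢w = ⊥-elim (∄ (x , x∈S , x∉A , x≢w))
  ∣S∣≤1 : ∣ S ∣ ≤ 1
  ∣S∣≤1 = subst (∣ S ∣ ≤_) (∣⁅x⁆∣≡1 w) (p⊆q⇒∣p∣≤∣q∣ S⊆⁅w⁆)

Antichain : Family n → Set
Antichain H = ∀ A B → H A → H B → ¬ (A ⊂ B)

antichain∧𝒰⊆⇒𝒰≐ : ∀ {r} {H : Family n} → Antichain H → r ≤ n →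
                   (∀ S → 𝒰 r S → H S) → 𝒰 r ≐ H
antichain∧𝒰⊆⇒𝒰≐ {n} {r} {H} antichain r≤n 𝒰⊆H S = mk⇔ (𝒰⊆H S) (sized S)
  where
  sized : ∀ A → H A → ∣ A ∣ ≡ r
  sized A HA with ∣ A ∣ ≟ r
  ... | yes ∣A∣≡r = ∣A∣≡r
  ... | no ∣A∣≢r with ≤-total ∣ A ∣ r
  ... | inj₁ ∣A∣≤r
    with m , A⊆m , _ , ∣m∣≡r ← ⊆-sandwich A ⊤ ⊆⊤ r ∣A∣≤r (subst (r ≤_) (sym (∣⊤∣≡n n)) r≤n)
    = ⊥-elim (antichain A m HA (𝒰⊆H m ∣m∣≡r) (⊆∧≢⇒⊂ A⊆m λ { refl → ∣A∣≢r ∣m∣≡r }))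
  ... | inj₂ r≤∣A∣
    with m , _ , m⊆A , ∣m∣≡r ← ⊆-sandwich ⊥ A ⊥⊆ r (subst (_≤ r) (sym (∣⊥∣≡0 n)) z≤n) r≤∣A∣
    = ⊥-elim (antichain m A (𝒰⊆H m ∣m∣≡r) HA (⊆∧≢⇒⊂ m⊆A λ { refl → ∣A∣≢r ∣m∣≡r }))

_≟ₛ_ : (p q : Subset n) → Dec (p ≡ q)
_≟ₛ_ = ≡-dec Bool._≟_

-- Decided by inspecting the witnesses of 𝒰 r ⩽ H; these may depend on the proof of
-- ∣ S ∣ ≡ r, which is harmless since such proofs are unique.
𝒰⩽⇒strictly-below⊎𝒰⊆ : ∀ {r} {H : Family n} → 𝒰 r ⩽ H →
  (∃₂ λ S A → 𝒰 r S × H A × A ⊂ S) ⊎ (∀ S → 𝒰 r S → H S)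
𝒰⩽⇒strictly-below⊎𝒰⊆ {n} {r} {H} 𝒰⩽H with anySubset? proper?
  where
  Proper : Subset n → Set
  Proper S = Σ (𝒰 r S) λ ∣S∣≡r → proj₁ (𝒰⩽H S ∣S∣≡r) ≢ S
  proper? : ∀ S → Dec (Proper S)
  proper? S with ∣ S ∣ ≟ r
  ... | no ∣S∣≢r = no λ (∣S∣≡r , _) → ∣S∣≢r ∣S∣≡r
  ... | yes ∣S∣≡r with proj₁ (𝒰⩽H S ∣S∣≡r) ≟ₛ S
  ...   | no A≢S = yes (∣S∣≡r , A≢S)
  ...   | yes A≡S = no λ (e , A≢S) →
          A≢S (subst (λ e → proj₁ (𝒰⩽H S e) ≡ S) (≡-irrelevant ∣S∣≡r e) A≡S)
... | yes (S , ∣S∣≡r , A≢S) with A , HA , A⊆S ← 𝒰⩽H S ∣S∣≡r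
  = inj₁ (S , A , ∣S∣≡r , HA , ⊆∧≢⇒⊂ A⊆S A≢S)
... | no ∄ = inj₂ λ S ∣S∣≡r → member (𝒰⩽H S ∣S∣≡r) λ A≢S → ∄ (S , ∣S∣≡r , A≢S)
  where
  member : ∀ {S} (w : ∃ λ A → H A × A ⊆ S) → ¬ (proj₁ w ≢ S) → H S
  member {S} (A , HA , _) ¬A≢S with A ≟ₛ S
  ... | yes refl = HA
  ... | no A≢S = contradiction A≢S ¬A≢S

module _ (G : Graph n) where

  Adj-sym : ∀ {u v} → Adj G u v → Adj G v u
  Adj-sym {u} {v} uv = trans (Graph.sym G v u) uv

  ¬Adj-refl : ∀ v → ¬ Adj G v v
  ¬Adj-refl v vv with () ← trans (sym vv) (Graph.irrefl G v)

  ⊆⁅x⁆⇒¬dominating : ∀ {D x y} → D ⊆ ⁅ x ⁆ → y ∉ D → ¬ Adj G x y → ¬ IsDominating G D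
  ⊆⁅x⁆⇒¬dominating {x = x} D⊆⁅x⁆ y∉D ¬xy dominating
    with u , u∈D , uy ← dominating _ y∉D
    with refl ← x∈⁅y⁆⇒x≡y x (D⊆⁅x⁆ u∈D) = ¬xy uy

  universal⇒minDominating : ∀ {x} → (∀ v → v ≢ x → Adj G x v) → IsMinDominating G ⁅ x ⁆
  universal⇒minDominating {x} x~ = dominating , minimal
    where
    dominating : IsDominating G ⁅ x ⁆
    dominating v v∉⁅x⁆ = x , x∈⁅x⁆ x , x~ v (x∉⁅y⁆⇒x≢y v∉⁅x⁆)
    minimal : ∀ D → D ⊂ ⁅ x ⁆ → ¬ IsDominating G D
    minimal D (D⊆⁅x⁆ , z , z∈⁅x⁆ , z∉D) with refl ← x∈⁅y⁆⇒x≡y x z∈⁅x⁆ =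
      ⊆⁅x⁆⇒¬dominating D⊆⁅x⁆ z∉D (¬Adj-refl x)

  nonadjacent-pair⇒minDominating : ∀ {x y} → ¬ Adj G x y →
    (∀ v → v ∉ ⁅ x ⁆ ∪ ⁅ y ⁆ → Adj G x v ⊎ Adj G y v) → IsMinDominating G (⁅ x ⁆ ∪ ⁅ y ⁆)
  nonadjacent-pair⇒minDominating {x} {y} ¬xy x,y~ = dominating , minimal
    where
    dominating : IsDominating G (⁅ x ⁆ ∪ ⁅ y ⁆)
    dominating v v∉ with x,y~ v v∉
    ... | inj₁ xv = x , p⊆p∪q ⁅ y ⁆ (x∈⁅x⁆ x) , xv
    ... | inj₂ yv = y , q⊆p∪q ⁅ x ⁆ ⁅ y ⁆ (x∈⁅x⁆ y) , yv
    minimal : ∀ D → D ⊂ ⁅ x ⁆ ∪ ⁅ y ⁆ → ¬ IsDominating G D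
    minimal D (D⊆ , z , z∈ , z∉D) with x∈p∪q⁻ ⁅ x ⁆ ⁅ y ⁆ z∈
    ... | inj₁ z∈⁅x⁆ with refl ← x∈⁅y⁆⇒x≡y x z∈⁅x⁆ =
      ⊆⁅x⁆⇒¬dominating (⊆⁅x⁆∪q∧x∉⇒⊆q D⊆ z∉D) z∉D (¬xy ∘ Adj-sym)
    ... | inj₂ z∈⁅y⁆ with refl ← x∈⁅y⁆⇒x≡y y z∈⁅y⁆ =
      ⊆⁅x⁆⇒¬dominating (⊆⁅x⁆∪q∧x∉⇒⊆q (subst (D ⊆_) (∪-comm ⁅ x ⁆ ⁅ y ⁆) D⊆) z∉D) z∉D ¬xy

module CompleteWithoutStar (A : Subset n) (w : Fin n) (w∉A : w ∉ A) where

  Deleted : Fin n → Fin n → Set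
  Deleted u v = u ≡ w × v ∈ A

  Edge : Fin n → Fin n → Set
  Edge u v = u ≢ v × ¬ Deleted u v × ¬ Deleted v u

  deleted? : ∀ u v → Dec (Deleted u v)
  deleted? u v = (u Fin.≟ w) ×-dec (v ∈? A)

  edge? : ∀ u v → Dec (Edge u v)
  edge? u v = ¬? (u Fin.≟ v) ×-dec ¬? (deleted? u v) ×-dec ¬? (deleted? v u)

  Edge-sym : ∀ {u v} → Edge u v → Edge v u
  Edge-sym (u≢v , ¬uv , ¬vu) = u≢v ∘ sym , ¬vu , ¬uv

  G : Graph n
  G = record
    { adj    = λ u v → does (edge? u v)
    ; sym    = λ u v → does-⇔ (mk⇔ Edge-sym Edge-sym) (edge? u v) (edge? v u)
    ; irrefl = λ v → dec-false (edge? v v) λ (v≢v , _) → v≢v refl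
    }

  edge⇒adj : ∀ {u v} → Edge u v → Adj G u v
  edge⇒adj {u} {v} = dec-true (edge? u v)

  adj⇒edge : ∀ {u v} → Adj G u v → Edge u v
  adj⇒edge {u} {v} uv = decidable-stable (edge? u v) λ ¬edge →
    contradiction (trans (sym uv) (dec-false (edge? u v) ¬edge)) λ ()

  ¬adj-w-A : ∀ {a} → a ∈ A → ¬ Adj G w a
  ¬adj-w-A a∈A wa = proj₁ (proj₂ (adj⇒edge wa)) (refl , a∈A)

  minDominating-⁅x⁆ : ∀ {x} → x ∉ A → x ≢ w → IsMinDominating G ⁅ x ⁆
  minDominating-⁅x⁆ {x} x∉A x≢w = universal⇒minDominating G λ v v≢x →
    edge⇒adj {x} {v} (v≢x ∘ sym , (λ (x≡w , _) → x≢w x≡w) , λ (_ , x∈A) → x∉A x∈A)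

  minDominating-⁅w⁆∪⁅a⁆ : ∀ {a} → a ∈ A → IsMinDominating G (⁅ w ⁆ ∪ ⁅ a ⁆)
  minDominating-⁅w⁆∪⁅a⁆ {a} a∈A = nonadjacent-pair⇒minDominating G (¬adj-w-A a∈A) λ v v∉ →
    inj₂ (edge⇒adj {a} {v} ( (λ { refl → v∉ (q⊆p∪q ⁅ w ⁆ ⁅ a ⁆ (x∈⁅x⁆ a)) })
                   , (λ { (refl , _) → w∉A a∈A })
                   , (λ { (refl , _) → v∉ (p⊆p∪q ⁅ a ⁆ (x∈⁅x⁆ w)) })))

  ⊆A⇒¬dominating : ∀ {D} → D ⊆ A → ¬ IsDominating G D
  ⊆A⇒¬dominating D⊆A dominating with u , u∈D , uw ← dominating w (w∉A ∘ D⊆A) =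
    ¬adj-w-A (D⊆A u∈D) (Adj-sym G {u} uw)

  𝒟-groundSet : ∀ {a} → a ∈ A → HasGroundSet (𝒟 G)
  𝒟-groundSet {a} a∈A x with x Fin.≟ w | x ∈? A
  ... | yes refl | _ = ⁅ x ⁆ ∪ ⁅ a ⁆ , minDominating-⁅w⁆∪⁅a⁆ a∈A , p⊆p∪q ⁅ a ⁆ (x∈⁅x⁆ x)
  ... | no _ | yes x∈A = ⁅ w ⁆ ∪ ⁅ x ⁆ , minDominating-⁅w⁆∪⁅a⁆ x∈A , q⊆p∪q ⁅ w ⁆ ⁅ x ⁆ (x∈⁅x⁆ x)
  ... | no x≢w | no x∉A = ⁅ x ⁆ , minDominating-⁅x⁆ x∉A x≢w , x∈⁅x⁆ x

  𝒰⩽𝒟 : ∀ {r a} → a ∈ A → ∣ A ∣ < r → 𝒰 r ⩽ 𝒟 G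
  𝒰⩽𝒟 {r} {a} a∈A ∣A∣<r S ∣S∣≡r
    with escapes⊎straddles (subst (∣ A ∣ <_) (sym ∣S∣≡r) ∣A∣<r) (subst (1 <_) (sym ∣S∣≡r) 1<r)
    where
    1<r : 1 < r
    1<r = ≤-<-trans (subst (_≤ ∣ A ∣) (∣⁅x⁆∣≡1 a) (p⊆q⇒∣p∣≤∣q∣ (x∈p⇒⁅x⁆⊆p a∈A))) ∣A∣<r
  ... | inj₁ (x , x∈S , x∉A , x≢w) = ⁅ x ⁆ , minDominating-⁅x⁆ x∉A x≢w , x∈p⇒⁅x⁆⊆p x∈S
  ... | inj₂ (w∈S , b , b∈S , b∈A) =
    ⁅ w ⁆ ∪ ⁅ b ⁆ , minDominating-⁅w⁆∪⁅a⁆ b∈A , x,y∈p⇒⁅x⁆∪⁅y⁆⊆p w∈S b∈S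

  ⋬𝒟 : ∀ {H : Family n} → H A → ¬ (H ⩽ 𝒟 G)
  ⋬𝒟 HA H⩽𝒟 with D , (dominating , _) , D⊆A ← H⩽𝒟 _ HA = ⊆A⇒¬dominating D⊆A dominating

lemma3p3 : (n r : ℕ) → 1 ≤ r → r ≤ n → (H : Family n) → IsHypergraph H →
    𝒰 {n} r ⩽ H → ¬ (𝒰 {n} r ≐ H) →
    Σ (Family n) (λ H₀ → InDom r H₀ × ¬ (H ⩽ H₀))
lemma3p3 n r _ r≤n H (_ , nonempty , antichain) 𝒰⩽H 𝒰≭H with 𝒰⩽⇒strictly-below⊎𝒰⊆ 𝒰⩽H
... | inj₂ 𝒰⊆H = ⊥-elim (𝒰≭H (antichain∧𝒰⊆⇒𝒰≐ antichain r≤n 𝒰⊆H))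
... | inj₁ (S , A , ∣S∣≡r , HA , A⊂S@(_ , w , _ , w∉A)) with a , a∈A ← nonempty A HA =
  𝒟 G , ((G , λ _ → mk⇔ id id) , 𝒟-groundSet a∈A , 𝒰⩽𝒟 a∈A ∣A∣<r) , ⋬𝒟 HA
  where
  open CompleteWithoutStar A w w∉A
  ∣A∣<r : ∣ A ∣ < r
  ∣A∣<r = subst (∣ A ∣ <_) ∣S∣≡r (p⊂q⇒∣p∣<∣q∣ A⊂S)
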